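{- Let $n \ge k \ge r \ge 2$ be integers and let $\mathcal{H}$ be a $k$-colorable $r$-graph on $n$ vertices without isolated vertices satisfying \[ \delta_{r-1}^{+}(\mathcal{H}) > \max\left\{\frac{3k-3r+1}{3k-2}\, n,\ \frac{k-r+1}{k+2}\, n\right\}. \] Let $\varphi\in\mathrm{Hom}(\mathcal{H},K_k^r)$. For every pair of distinct vertices $\{u,v\}$ contained in some edge of $\mathcal{H}$, there exists an edge $e\in\mathcal{H}$ containing $\{u,v\}$ such that $|[w]_\varphi|\ge |\varphi^{ -1}(i)|$ for every $w\in e\setminus\{u,v\}$ and every $i\in[k]\setminus\varphi(e)$. In particular, $|\varphi^{ -1}(i)|<\frac{3n}{3k-2}$ for every $i\in[k]\setminus\varphi(e)$.
   Context: An $r$-graph $\mathcal{H}$ is a collection of $r$-element subsets (edges) of a finite vertex set $V(\mathcal{H})$; a vertex is isolated if it lies in no edge. $\partial\mathcal{H}$ is the set of $(r-1)$-sets contained in some edge; for an $(r-1)$-set $S$, $d_{\mathcal{H}}(S)$ is the number of vertices $v$ with $S\cup\{v\}\in\mathcal{H}$, and $\delta^{+}_{r-1}(\mathcal{H})=\min\{d_{\mathcal{H}}(S): S\in\partial\mathcal{H}\}$. $\mathrm{Hom}(\mathcal{H},K_k^r)$ is the set of maps $\varphi:V(\mathcal{H})\to[k]$ that are injective on every edge; $\mathcal{H}$ is $k$-colorable if this set is nonempty. For a vertex $w$, $[w]_\varphi=\{x\in V(\mathcal{H}):\varphi(x)=\varphi(w)\}$; $\varphi(e)=\{\varphi(x):x\in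 e\}$. -}

module Defs where

open import Data.Nat using (ℕ; _∸_; _+_; _*_; _<_; _≥_)
open import Data.Bool using (Bool; true; false; if_then_else_; not; _∧_)
open import Data.Fin using (Fin; toℕ)
open import Data.Nat.Base using (_≡ᵇ_)
open import Data.Fin.Subset using (Subset; _∈_; _∉_; _⊆_; _∪_; ⁅_⁆; ∣_∣)
open import Data.Vec using (lookup)
open import Data.List using (List; map; allFin)
open import Data.Nat.ListAction using (sum)
open import Data.Product using (Σ; _×_; ∃; ∃-syntax)
open import Relation.Binary.PropositionalEquality using (_≡_; _≢_)
open import Relation.Nullary using (¬_)

-- An r-graph on vertex set Fin n is given by a Boolean edge-indicator
-- H : Subset n → Bool; e is an edge iff H e ≡ true.
Edge : ∀ {n} → (Subset n → Bool) → Subset n → Set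
Edge H e = H e ≡ true

IsRGraph : ∀ {n} → ℕ → (Subset n → Bool) → Set
IsRGraph {n} r H = ∀ (e : Subset n) → Edge H e → ∣ e ∣ ≡ r

NoIsolated : ∀ {n} → (Subset n → Bool) → Set
NoIsolated {n} H = ∀ (x : Fin n) → ∃[ e ] (Edge H e × x ∈ e)

count : ∀ {n} → (Fin n → Bool) → ℕ
count {n} f = sum (map (λ x → if f x then 1 else 0) (allFin n))

InShadow : ∀ {n} → ℕ → (Subset n → Bool) → Subset n → Set
InShadow r H S = (∣ S ∣ ≡ r ∸ 1) × ∃[ e ] (Edge H e × S ⊆ e)

degree : ∀ {n} → (Subset n → Bool) → Subset n → ℕ
degree H S = count (λ v → not (lookup S v) ∧ H (S ∪ ⁅ v ⁆))

-- φ ∈ Hom(H, K_k^r): injective on every edge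
IsHom : ∀ {n k} → (Subset n → Bool) → (Fin n → Fin k) → Set
IsHom {n} H φ = ∀ (e : Subset n) → Edge H e →
  ∀ (x y : Fin n) → x ∈ e → y ∈ e → φ x ≡ φ y → x ≡ y

Colorable : ∀ {n} → ℕ → (Subset n → Bool) → Set
Colorable {n} k H = Σ (Fin n → Fin k) (λ φ → IsHom H φ)

preimageSize : ∀ {n k} → (Fin n → Fin k) → Fin k → ℕ
preimageSize φ i = count (λ x → toℕ (φ x) ≡ᵇ toℕ i)

classSize : ∀ {n k} → (Fin n → Fin k) → Fin n → ℕ
classSize φ w = preimageSize φ (φ w)

InImage : ∀ {n k} → (Fin n → Fin k) → Subset n → Fin k → Set
InImage φ e i = ∃[ x ] (x ∈ e × φ x ≡ i)

-- δ⁺_{r-1}(H) > (a / b) n, written cross-multiplied (b > 0):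
-- every S ∈ ∂H has d_H(S) * b > a * n.
MinPosCodegreeAbove : ∀ {n} → ℕ → (Subset n → Bool) → ℕ → ℕ → Set
MinPosCodegreeAbove {n} r H a b =
  ∀ (S : Subset n) → InShadow r H S → a * n < degree H S * b

-- Write g x for the size of the colour class of x.  Among the shadows containing u and v
-- take S of maximal total g-weight, and in its link a vertex z of maximal g; the edge is
-- e = S ∪ {z}.  Trading any w ∈ S ∖ {u, v} for z keeps a shadow through u and v, so
-- g z ≤ g w.  Everything else rests on one double count: if Z is rainbow and no vertex in
-- the link of a shadow T has a colour occurring on Z, then that link and the colour classes
-- of Z are disjoint, so deg T + Σ_{y ∈ Z} g y ≤ n; if in addition all link classes have
-- size at most μ, then deg T ≤ (k − |Z|) μ.  Against the codegree bound this rules out a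
-- colour class missing from e that is larger than g z (look at a heaviest shadow through a
-- vertex of that colour), and it bounds every missing class by 3n / (3k − 2).

module Submission where

open import Defs
open import Data.Nat using (ℕ; >-nonZero⁻¹; zero; suc; _≤_; _≰_; _<_; _+_; _*_; _∸_; z≤n; s≤s; _≡ᵇ_)
open import Data.Nat.Properties
open import Data.Bool using (Bool; true; false; if_then_else_; not; _∧_)
open import Data.Fin using (Fin; zero; suc; toℕ)
open import Data.Fin.Subset
  using (Subset; _∈_; _∉_; _⊆_; _∪_; _-_; ⁅_⁆; ∣_∣; ⊥; ⊤; ∁; Nonempty; inside; outside)
open import Data.Fin.Subset.Properties
import Data.Fin.Properties as Finₚ
open import Data.Fin.Properties using (any?; nonZeroIndex)
open import Data.Vec using ([]; _∷_; here; there; lookup; tabulate)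
open import Data.Vec.Properties using (lookup∘tabulate; lookup-replicate; []=⇒lookup; lookup⇒[]=; tabulate-cong)
open import Data.Nat.ListAction using (sum)
import Data.List as List using (tabulate)
import Data.List.Properties as List using (map-tabulate)
open import Data.Product using (_×_; _,_; ∃; ∃-syntax; proj₁; proj₂)
open import Data.Sum using (_⊎_; inj₁; inj₂)
import Data.Empty as Empty
import Data.Bool.Properties as Boolₚ
open import Function using (_∘_; id; const)
open import Relation.Binary.PropositionalEquality
open import Relation.Nullary using (¬_; Dec; yes; no; contradiction)
open import Relation.Nullary.Decidable using (_×-dec_; ¬?)
open import Data.Nat.Tactic.RingSolver using (solve-∀)

private
  variable
    n k : ℕ

-- Subsets

x∉p-x : ∀ (p : Subset n) x → x ∉ p - x
x∉p-x (inside ∷ p)  zero    ()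
x∉p-x (outside ∷ p) zero    ()
x∉p-x (_ ∷ p)       (suc x) (there x∈p-x) = x∉p-x p x x∈p-x

x∈p-y⇒x≢y : ∀ {p : Subset n} {x y} → x ∈ p - y → x ≢ y
x∈p-y⇒x≢y {p = p} x∈p-x refl = x∉p-x p _ x∈p-x

x∈p-y⁻ : ∀ {p : Subset n} {x y} → x ∈ p - y → x ∈ p × x ≢ y
x∈p-y⁻ {p = p} {y = y} x∈p-y = p─q⊆p p ⁅ y ⁆ x∈p-y , x∈p-y⇒x≢y x∈p-y

x∈p⇒⁅x⁆⊆p : ∀ {p : Subset n} {x} → x ∈ p → ⁅ x ⁆ ⊆ p
x∈p⇒⁅x⁆⊆p {p = p} {x} x∈p y∈⁅x⁆ = subst (_∈ p) (sym (x∈⁅y⁆⇒x≡y x y∈⁅x⁆)) x∈p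

⁅x⁆∪⁅y⁆⊆p : ∀ {p : Subset n} {x y} → x ∈ p → y ∈ p → ⁅ x ⁆ ∪ ⁅ y ⁆ ⊆ p
⁅x⁆∪⁅y⁆⊆p {x = x} {y} x∈p y∈p z∈⁅x⁆∪⁅y⁆ with x∈p∪q⁻ ⁅ x ⁆ ⁅ y ⁆ z∈⁅x⁆∪⁅y⁆
... | inj₁ z∈⁅x⁆ = x∈p⇒⁅x⁆⊆p x∈p z∈⁅x⁆
... | inj₂ z∈⁅y⁆ = x∈p⇒⁅x⁆⊆p y∈p z∈⁅y⁆

x∉⁅y⁆∪⁅z⁆ : ∀ {x y z : Fin n} → x ≢ y → x ≢ z → x ∉ ⁅ y ⁆ ∪ ⁅ z ⁆
x∉⁅y⁆∪⁅z⁆ {y = y} {z} x≢y x≢z x∈⁅y⁆∪⁅z⁆ with x∈p∪q⁻ ⁅ y ⁆ ⁅ z ⁆ x∈⁅y⁆∪⁅z⁆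
... | inj₁ x∈⁅y⁆ = x≢y (x∈⁅y⁆⇒x≡y y x∈⁅y⁆)
... | inj₂ x∈⁅z⁆ = x≢z (x∈⁅y⁆⇒x≡y z x∈⁅z⁆)

∣p∣>0⇒Nonempty : ∀ (p : Subset n) → 0 < ∣ p ∣ → Nonempty p
∣p∣>0⇒Nonempty {n} p 0<∣p∣ with nonempty? p
... | yes ∃x = ∃x
... | no ∄x = contradiction (trans (cong ∣_∣ (Empty-unique ∄x)) (∣⊥∣≡0 n)) (>⇒≢ 0<∣p∣)

count-tabulate : ∀ (f : Fin n → Bool) → count f ≡ ∣ tabulate f ∣
count-tabulate f = trans (cong sum (List.map-tabulate id (λ x → if f x then 1 else 0))) (sum-indicators f)
  where
  sum-indicators : ∀ {n} (f : Fin n → Bool) →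
                   sum (List.tabulate (λ x → if f x then 1 else 0)) ≡ ∣ tabulate f ∣
  sum-indicators {zero}  f = refl
  sum-indicators {suc n} f with f zero
  ... | true  = cong suc (sum-indicators (f ∘ suc))
  ... | false = sum-indicators (f ∘ suc)

lookup-⁅⁆ : ∀ (i j : Fin n) → lookup ⁅ i ⁆ j ≡ (toℕ j ≡ᵇ toℕ i)
lookup-⁅⁆ zero    zero    = refl
lookup-⁅⁆ zero    (suc j) = lookup-replicate j outside
lookup-⁅⁆ (suc i) zero    = refl
lookup-⁅⁆ (suc i) (suc j) = lookup-⁅⁆ i j

∣b∷p∣ : ∀ b (p : Subset n) → ∣ b ∷ p ∣ ≡ (if b then 1 else 0) + ∣ p ∣
∣b∷p∣ true  p = refl
∣b∷p∣ false p = refl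

-- Weights of subsets

weight : Subset n → (Fin n → ℕ) → ℕ
weight []            g = 0
weight (inside ∷ p)  g = g zero + weight p (g ∘ suc)
weight (outside ∷ p) g = weight p (g ∘ suc)

weight-const : ∀ (p : Subset n) c → weight p (const c) ≡ ∣ p ∣ * c
weight-const []            c = refl
weight-const (inside ∷ p)  c = cong (c +_) (weight-const p c)
weight-const (outside ∷ p) c = weight-const p c

∣p∣≡weight : ∀ (p : Subset n) → ∣ p ∣ ≡ weight p (const 1)
∣p∣≡weight p = sym (trans (weight-const p 1) (*-identityʳ ∣ p ∣))

weight-zero : ∀ (p : Subset n) → weight p (const 0) ≡ 0
weight-zero p = trans (weight-const p 0) (*-zeroʳ ∣ p ∣)

weight-⊥ : ∀ (g : Fin n → ℕ) → weight ⊥ g ≡ 0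
weight-⊥ {zero}  g = refl
weight-⊥ {suc n} g = weight-⊥ (g ∘ suc)

weight-⁅⁆ : ∀ (x : Fin n) g → weight ⁅ x ⁆ g ≡ g x
weight-⁅⁆ zero    g = trans (cong (g zero +_) (weight-⊥ (g ∘ suc))) (+-identityʳ (g zero))
weight-⁅⁆ (suc x) g = weight-⁅⁆ x (g ∘ suc)

weight-mono-⊆ : ∀ {p q : Subset n} g → p ⊆ q → weight p g ≤ weight q g
weight-mono-⊆ {p = []}          {[]}          g p⊆q = z≤n
weight-mono-⊆ {p = inside ∷ p}  {inside ∷ q}  g p⊆q =
  +-monoʳ-≤ (g zero) (weight-mono-⊆ (g ∘ suc) (drop-∷-⊆ p⊆q))
weight-mono-⊆ {p = inside ∷ p}  {outside ∷ q} g p⊆q with () ← p⊆q here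
weight-mono-⊆ {p = outside ∷ p} {inside ∷ q}  g p⊆q =
  m≤n⇒m≤o+n (g zero) (weight-mono-⊆ (g ∘ suc) (drop-∷-⊆ p⊆q))
weight-mono-⊆ {p = outside ∷ p} {outside ∷ q} g p⊆q = weight-mono-⊆ (g ∘ suc) (drop-∷-⊆ p⊆q)

weight-mono-≤ : ∀ (p : Subset n) {g h} → (∀ {x} → x ∈ p → g x ≤ h x) → weight p g ≤ weight p h
weight-mono-≤ []            g≤h = z≤n
weight-mono-≤ (inside ∷ p)  g≤h = +-mono-≤ (g≤h here) (weight-mono-≤ p (g≤h ∘ there))
weight-mono-≤ (outside ∷ p) g≤h = weight-mono-≤ p (g≤h ∘ there)

∣p∣*c≤weight : ∀ (p : Subset n) {g c} → (∀ {x} → x ∈ p → c ≤ g x) → ∣ p ∣ * c ≤ weight p g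
∣p∣*c≤weight p {c = c} c≤g = subst (_≤ _) (weight-const p c) (weight-mono-≤ p c≤g)

weight≤∣p∣*c : ∀ (p : Subset n) {g c} → (∀ {x} → x ∈ p → g x ≤ c) → weight p g ≤ ∣ p ∣ * c
weight≤∣p∣*c p {c = c} g≤c = subst (_ ≤_) (weight-const p c) (weight-mono-≤ p g≤c)

weight-∪ : ∀ (p q : Subset n) g → (∀ {x} → x ∈ p → x ∉ q) →
           weight (p ∪ q) g ≡ weight p g + weight q g
weight-∪ []            []            g p∩q≡∅ = refl
weight-∪ (inside ∷ p)  (inside ∷ q)  g p∩q≡∅ = contradiction here (p∩q≡∅ here)
weight-∪ (inside ∷ p)  (outside ∷ q) g p∩q≡∅ =
  trans (cong (g zero +_) (weight-∪ p q (g ∘ suc) (λ x∈p → p∩q≡∅ (there x∈p) ∘ there)))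
        (sym (+-assoc (g zero) _ _))
weight-∪ (outside ∷ p) (inside ∷ q)  g p∩q≡∅ =
  trans (cong (g zero +_) (weight-∪ p q (g ∘ suc) (λ x∈p → p∩q≡∅ (there x∈p) ∘ there)))
        (x+[y+z]≡y+[x+z] (g zero) (weight p (g ∘ suc)) (weight q (g ∘ suc)))
  where
  x+[y+z]≡y+[x+z] : ∀ x y z → x + (y + z) ≡ y + (x + z)
  x+[y+z]≡y+[x+z] = solve-∀
weight-∪ (outside ∷ p) (outside ∷ q) g p∩q≡∅ =
  weight-∪ p q (g ∘ suc) (λ x∈p → p∩q≡∅ (there x∈p) ∘ there)

weight-∪⁅⁆ : ∀ (p : Subset n) {x} g → x ∉ p → weight (p ∪ ⁅ x ⁆) g ≡ weight p g + g x
weight-∪⁅⁆ p {x} g x∉p = trans (weight-∪ p ⁅ x ⁆ g p∩⁅x⁆≡∅) (cong (weight p g +_) (weight-⁅⁆ x g))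
  where
  p∩⁅x⁆≡∅ : ∀ {y} → y ∈ p → y ∉ ⁅ x ⁆
  p∩⁅x⁆≡∅ y∈p y∈⁅x⁆ = x∉p (subst (_∈ p) (x∈⁅y⁆⇒x≡y x y∈⁅x⁆) y∈p)

weight-minus : ∀ (p : Subset n) {x} g → x ∈ p → weight (p - x) g + g x ≡ weight p g
weight-minus (inside ∷ p)  {zero}  g here =
  trans (+-comm _ (g zero)) (cong (λ q → g zero + weight q (g ∘ suc)) (p─⊥≡p p))
weight-minus (inside ∷ p)  {suc x} g (there x∈p) =
  trans (+-assoc (g zero) _ _) (cong (g zero +_) (weight-minus p (g ∘ suc) x∈p))
weight-minus (outside ∷ p) {suc x} g (there x∈p) = weight-minus p (g ∘ suc) x∈p

weight-cong : ∀ (p : Subset n) {g h} → (∀ x → g x ≡ h x) → weight p g ≡ weight p h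
weight-cong p g≗h = ≤-antisym (weight-mono-≤ p λ {x} _ → ≤-reflexive (g≗h x))
                              (weight-mono-≤ p λ {x} _ → ≤-reflexive (sym (g≗h x)))

weight-+ : ∀ (p : Subset n) g h → weight p (λ x → g x + h x) ≡ weight p g + weight p h
weight-+ []            g h = refl
weight-+ (inside ∷ p)  g h =
  trans (cong (g zero + h zero +_) (weight-+ p (g ∘ suc) (h ∘ suc)))
        ([a+b]+[c+d]≡[a+c]+[b+d] (g zero) (h zero) (weight p (g ∘ suc)) (weight p (h ∘ suc)))
  where
  [a+b]+[c+d]≡[a+c]+[b+d] : ∀ a b c d → (a + b) + (c + d) ≡ (a + c) + (b + d)
  [a+b]+[c+d]≡[a+c]+[b+d] = solve-∀
weight-+ (outside ∷ p) g h = weight-+ p (g ∘ suc) (h ∘ suc)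

1+∣p-x∣≡∣p∣ : ∀ (p : Subset n) {x} → x ∈ p → suc ∣ p - x ∣ ≡ ∣ p ∣
1+∣p-x∣≡∣p∣ p {x} x∈p = begin
  suc ∣ p - x ∣                 ≡⟨ +-comm 1 ∣ p - x ∣ ⟩
  ∣ p - x ∣ + 1                 ≡⟨ cong (_+ 1) (∣p∣≡weight (p - x)) ⟩
  weight (p - x) (const 1) + 1  ≡⟨ weight-minus p (const 1) x∈p ⟩
  weight p (const 1)            ≡⟨ ∣p∣≡weight p ⟨
  ∣ p ∣                         ∎
  where open ≡-Reasoning

∣p∪⁅x⁆∣≡1+∣p∣ : ∀ (p : Subset n) {x} → x ∉ p → ∣ p ∪ ⁅ x ⁆ ∣ ≡ suc ∣ p ∣
∣p∪⁅x⁆∣≡1+∣p∣ p {x} x∉p = begin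
  ∣ p ∪ ⁅ x ⁆ ∣                ≡⟨ ∣p∣≡weight (p ∪ ⁅ x ⁆) ⟩
  weight (p ∪ ⁅ x ⁆) (const 1) ≡⟨ weight-∪⁅⁆ p (const 1) x∉p ⟩
  weight p (const 1) + 1       ≡⟨ cong (_+ 1) (∣p∣≡weight p) ⟨
  ∣ p ∣ + 1                    ≡⟨ +-comm ∣ p ∣ 1 ⟩
  suc ∣ p ∣                    ∎
  where open ≡-Reasoning

∣p∣+∣q∣≤n : ∀ (p q : Subset n) → (∀ {x} → x ∈ p → x ∉ q) → ∣ p ∣ + ∣ q ∣ ≤ n
∣p∣+∣q∣≤n {n} p q p∩q≡∅ = begin
  ∣ p ∣ + ∣ q ∣                            ≡⟨ cong₂ _+_ (∣p∣≡weight p) (∣p∣≡weight q) ⟩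
  weight p (const 1) + weight q (const 1)  ≡⟨ weight-∪ p q (const 1) p∩q≡∅ ⟨
  weight (p ∪ q) (const 1)                 ≡⟨ ∣p∣≡weight (p ∪ q) ⟨
  ∣ p ∪ q ∣                                ≤⟨ ∣p∣≤n (p ∪ q) ⟩
  n                                        ∎
  where open ≤-Reasoning

weight-exchange : ∀ (S : Subset n) {v t} g → v ∉ S → t ∈ S ∪ ⁅ v ⁆ →
                  weight ((S ∪ ⁅ v ⁆) - t) g + g t ≡ weight S g + g v
weight-exchange S g v∉S t∈S∪v =
  trans (weight-minus (S ∪ ⁅ _ ⁆) g t∈S∪v) (weight-∪⁅⁆ S g v∉S)

-- Colour classes

weight-indicator-⁅⁆ : ∀ (C : Subset k) c →
                      weight C (λ j → if lookup ⁅ j ⁆ c then 1 else 0) ≡ (if lookup C c then 1 else 0)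
weight-indicator-⁅⁆ (inside ∷ C)  zero    = cong suc (weight-zero C)
weight-indicator-⁅⁆ (outside ∷ C) zero    = weight-zero C
weight-indicator-⁅⁆ (inside ∷ C)  (suc c) =
  cong₂ _+_ (cong (λ b → if b then 1 else 0) (lookup-replicate c outside)) (weight-indicator-⁅⁆ C c)
weight-indicator-⁅⁆ (outside ∷ C) (suc c) = weight-indicator-⁅⁆ C c

preimage : (Fin n → Fin k) → Subset k → Subset n
preimage φ C = tabulate (λ x → lookup C (φ x))

∈-preimage⁺ : ∀ (φ : Fin n → Fin k) {C x} → φ x ∈ C → x ∈ preimage φ C
∈-preimage⁺ φ {C} {x} φx∈C = lookup⇒[]= x _ (trans (lookup∘tabulate _ x) ([]=⇒lookup φx∈C))

∈-preimage⁻ : ∀ (φ : Fin n → Fin k) {C x} → x ∈ preimage φ C → φ x ∈ C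
∈-preimage⁻ φ {C} {x} x∈φ⁻¹C = lookup⇒[]= (φ x) C (trans (sym (lookup∘tabulate _ x)) ([]=⇒lookup x∈φ⁻¹C))

preimageSize≡∣preimage⁅⁆∣ : ∀ (φ : Fin n → Fin k) i → preimageSize φ i ≡ ∣ preimage φ ⁅ i ⁆ ∣
preimageSize≡∣preimage⁅⁆∣ φ i =
  trans (count-tabulate λ x → toℕ (φ x) ≡ᵇ toℕ i) (cong ∣_∣ (tabulate-cong λ x → sym (lookup-⁅⁆ i (φ x))))

∣preimage∣≡weight : ∀ (φ : Fin n → Fin k) C → ∣ preimage φ C ∣ ≡ weight C (preimageSize φ)
∣preimage∣≡weight {k = k} φ C =
  trans (∣preimage∣≡weight-classes φ) (weight-cong C (sym ∘ preimageSize≡∣preimage⁅⁆∣ φ))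
  where
  ∣preimage∣≡weight-classes : ∀ {n} (φ : Fin n → Fin k) →
                              ∣ preimage φ C ∣ ≡ weight C (λ j → ∣ preimage φ ⁅ j ⁆ ∣)
  ∣preimage∣≡weight-classes {zero}  φ = sym (weight-zero C)
  ∣preimage∣≡weight-classes {suc n} φ = begin
    ∣ preimage φ C ∣
      ≡⟨ ∣b∷p∣ _ (preimage (φ ∘ suc) C) ⟩
    (if lookup C (φ zero) then 1 else 0) + ∣ preimage (φ ∘ suc) C ∣
      ≡⟨ cong₂ _+_ (weight-indicator-⁅⁆ C (φ zero)) (sym (∣preimage∣≡weight-classes (φ ∘ suc))) ⟨
    weight C (λ j → if lookup ⁅ j ⁆ (φ zero) then 1 else 0) + weight C (λ j → ∣ preimage (φ ∘ suc) ⁅ j ⁆ ∣)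
      ≡⟨ weight-+ C _ _ ⟨
    weight C (λ j → (if lookup ⁅ j ⁆ (φ zero) then 1 else 0) + ∣ preimage (φ ∘ suc) ⁅ j ⁆ ∣)
      ≡⟨ weight-cong C (λ j → ∣b∷p∣ _ (preimage (φ ∘ suc) ⁅ j ⁆)) ⟨
    weight C (λ j → ∣ preimage φ ⁅ j ⁆ ∣)
      ∎
    where open ≡-Reasoning

preimageSize>0⇒∃ : ∀ (φ : Fin n → Fin k) i → 0 < preimageSize φ i → ∃ λ x → φ x ≡ i
preimageSize>0⇒∃ φ i 0<∣φ⁻¹i∣
  with x , x∈φ⁻¹i ← ∣p∣>0⇒Nonempty _ (subst (0 <_) (preimageSize≡∣preimage⁅⁆∣ φ i) 0<∣φ⁻¹i∣) =
  x , x∈⁅y⁆⇒x≡y i (∈-preimage⁻ φ x∈φ⁻¹i)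

image : (Fin n → Fin k) → Subset n → Subset k
image φ []            = ⊥
image φ (inside ∷ p)  = image (φ ∘ suc) p ∪ ⁅ φ zero ⁆
image φ (outside ∷ p) = image (φ ∘ suc) p

∈-image⁺ : ∀ (φ : Fin n → Fin k) {p x} → x ∈ p → φ x ∈ image φ p
∈-image⁺ φ {inside ∷ p}  here        = q⊆p∪q (image (φ ∘ suc) p) _ (x∈⁅x⁆ (φ zero))
∈-image⁺ φ {inside ∷ p}  (there x∈p) = p⊆p∪q ⁅ φ zero ⁆ (∈-image⁺ (φ ∘ suc) x∈p)
∈-image⁺ φ {outside ∷ p} (there x∈p) = ∈-image⁺ (φ ∘ suc) x∈p

∈-image⁻ : ∀ (φ : Fin n → Fin k) {p j} → j ∈ image φ p → ∃[ x ] (x ∈ p × φ x ≡ j)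
∈-image⁻ φ {[]}          j∈⊥ = contradiction j∈⊥ ∉⊥
∈-image⁻ φ {inside ∷ p}  j∈φp with x∈p∪q⁻ (image (φ ∘ suc) p) ⁅ φ zero ⁆ j∈φp
... | inj₁ j∈φp′ = let x , x∈p , φx≡j = ∈-image⁻ (φ ∘ suc) j∈φp′ in suc x , there x∈p , φx≡j
... | inj₂ j∈⁅φ0⁆ = zero , here , sym (x∈⁅y⁆⇒x≡y _ j∈⁅φ0⁆)
∈-image⁻ φ {outside ∷ p} j∈φp =
  let x , x∈p , φx≡j = ∈-image⁻ (φ ∘ suc) j∈φp in suc x , there x∈p , φx≡j

Rainbow : (Fin n → Fin k) → Subset n → Set
Rainbow φ p = ∀ {x y} → x ∈ p → y ∈ p → φ x ≡ φ y → x ≡ y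

classSize<⇒≢ : ∀ (φ : Fin n → Fin k) {x y} → classSize φ x < classSize φ y → φ x ≢ φ y
classSize<⇒≢ φ gx<gy φx≡φy = <-irrefl (cong (preimageSize φ) φx≡φy) gx<gy

Rainbow-⊆ : ∀ {φ : Fin n → Fin k} {p q} → q ⊆ p → Rainbow φ p → Rainbow φ q
Rainbow-⊆ q⊆p rainbow x∈q y∈q = rainbow (q⊆p x∈q) (q⊆p y∈q)

Rainbow-∪⁅⁆ : ∀ {φ : Fin n → Fin k} {p x} → Rainbow φ p → (∀ {y} → y ∈ p → φ y ≢ φ x) →
              Rainbow φ (p ∪ ⁅ x ⁆)
Rainbow-∪⁅⁆ {p = p} {x} rainbow fresh y∈p∪x z∈p∪x φy≡φz
  with x∈p∪q⁻ p ⁅ x ⁆ y∈p∪x | x∈p∪q⁻ p ⁅ x ⁆ z∈p∪x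
... | inj₁ y∈p   | inj₁ z∈p   = rainbow y∈p z∈p φy≡φz
... | inj₁ y∈p   | inj₂ z∈⁅x⁆ = contradiction (trans φy≡φz (cong _ (x∈⁅y⁆⇒x≡y x z∈⁅x⁆))) (fresh y∈p)
... | inj₂ y∈⁅x⁆ | inj₁ z∈p   = contradiction (trans (sym φy≡φz) (cong _ (x∈⁅y⁆⇒x≡y x y∈⁅x⁆))) (fresh z∈p)
... | inj₂ y∈⁅x⁆ | inj₂ z∈⁅x⁆ = trans (x∈⁅y⁆⇒x≡y x y∈⁅x⁆) (sym (x∈⁅y⁆⇒x≡y x z∈⁅x⁆))

weight-image : ∀ (φ : Fin n → Fin k) {p} w → Rainbow φ p → weight (image φ p) w ≡ weight p (w ∘ φ)
weight-image φ {[]}          w rainbow = weight-⊥ w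
weight-image φ {inside ∷ p}  w rainbow = begin
  weight (image (φ ∘ suc) p ∪ ⁅ φ zero ⁆) w ≡⟨ weight-∪⁅⁆ (image (φ ∘ suc) p) w φ0∉φp ⟩
  weight (image (φ ∘ suc) p) w + w (φ zero) ≡⟨ cong (_+ w (φ zero)) (weight-image (φ ∘ suc) w rainbow′) ⟩
  weight p (w ∘ φ ∘ suc) + w (φ zero)       ≡⟨ +-comm _ (w (φ zero)) ⟩
  w (φ zero) + weight p (w ∘ φ ∘ suc)       ∎
  where
  open ≡-Reasoning
  rainbow′ : Rainbow (φ ∘ suc) p
  rainbow′ x∈p y∈p φx≡φy = Finₚ.suc-injective (rainbow (there x∈p) (there y∈p) φx≡φy)
  φ0∉φp : φ zero ∉ image (φ ∘ suc) p
  φ0∉φp φ0∈φp with x , x∈p , φx≡φ0 ← ∈-image⁻ (φ ∘ suc) φ0∈φp with () ← rainbow (there x∈p) here φx≡φ0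
weight-image φ {outside ∷ p} w rainbow =
  weight-image (φ ∘ suc) w (λ x∈p y∈p φx≡φy → Finₚ.suc-injective (rainbow (there x∈p) (there y∈p) φx≡φy))

∣image∣≡∣p∣ : ∀ (φ : Fin n → Fin k) {p} → Rainbow φ p → ∣ image φ p ∣ ≡ ∣ p ∣
∣image∣≡∣p∣ φ {p} rainbow =
  trans (∣p∣≡weight (image φ p)) (trans (weight-image φ (const 1) rainbow) (sym (∣p∣≡weight p)))

ColourDisjoint : (Fin n → Fin k) → Subset n → Subset n → Set
ColourDisjoint φ p q = ∀ {x y} → x ∈ p → y ∈ q → φ x ≢ φ y

∣p∣+weight[classSize]≤n : ∀ (φ : Fin n → Fin k) {p Z} → Rainbow φ Z → ColourDisjoint φ p Z →
                          ∣ p ∣ + weight Z (classSize φ) ≤ n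
∣p∣+weight[classSize]≤n {n} φ {p} {Z} rainbow p∩Z≡∅ = begin
  ∣ p ∣ + weight Z (classSize φ)              ≡⟨ cong (∣ p ∣ +_) (weight-image φ (preimageSize φ) rainbow) ⟨
  ∣ p ∣ + weight (image φ Z) (preimageSize φ) ≡⟨ cong (∣ p ∣ +_) (∣preimage∣≡weight φ (image φ Z)) ⟨
  ∣ p ∣ + ∣ preimage φ (image φ Z) ∣          ≤⟨ ∣p∣+∣q∣≤n p _ disjoint ⟩
  n                                           ∎
  where
  open ≤-Reasoning
  disjoint : ∀ {x} → x ∈ p → x ∉ preimage φ (image φ Z)
  disjoint x∈p x∈φ⁻¹φZ with y , y∈Z , φy≡φx ← ∈-image⁻ φ (∈-preimage⁻ φ x∈φ⁻¹φZ) =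
    p∩Z≡∅ x∈p y∈Z (sym φy≡φx)

∣p∣≤[k∸∣Z∣]*μ : ∀ (φ : Fin n → Fin k) {p Z μ} → Rainbow φ Z → ColourDisjoint φ p Z →
                (∀ {x} → x ∈ p → classSize φ x ≤ μ) → ∣ p ∣ ≤ (k ∸ ∣ Z ∣) * μ
∣p∣≤[k∸∣Z∣]*μ {k = k} φ {p} {Z} {μ} rainbow p∩Z≡∅ small = begin
  ∣ p ∣                               ≤⟨ p⊆q⇒∣p∣≤∣q∣ (∈-preimage⁺ φ ∘ ∈-image⁺ φ {p}) ⟩
  ∣ preimage φ (image φ p) ∣          ≡⟨ ∣preimage∣≡weight φ (image φ p) ⟩
  weight (image φ p) (preimageSize φ) ≤⟨ weight≤∣p∣*c (image φ p) small-class ⟩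
  ∣ image φ p ∣ * μ                   ≤⟨ *-monoˡ-≤ μ (p⊆q⇒∣p∣≤∣q∣ φp⊆∁φZ) ⟩
  ∣ ∁ (image φ Z) ∣ * μ               ≡⟨ cong (_* μ) (∣∁p∣≡n∸∣p∣ (image φ Z)) ⟩
  (k ∸ ∣ image φ Z ∣) * μ             ≡⟨ cong (λ m → (k ∸ m) * μ) (∣image∣≡∣p∣ φ rainbow) ⟩
  (k ∸ ∣ Z ∣) * μ                     ∎
  where
  open ≤-Reasoning
  small-class : ∀ {j} → j ∈ image φ p → preimageSize φ j ≤ μ
  small-class j∈φp with x , x∈p , refl ← ∈-image⁻ φ j∈φp = small x∈p
  φp⊆∁φZ : image φ p ⊆ ∁ (image φ Z)
  φp⊆∁φZ j∈φp with x , x∈p , refl ← ∈-image⁻ φ j∈φp = x∉p⇒x∈∁p λ φx∈φZ →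
    let y , y∈Z , φy≡φx = ∈-image⁻ φ φx∈φZ in p∩Z≡∅ x∈p y∈Z (sym φy≡φx)

-- Maxima

maximum-attained : ∀ {a ℓ} {A : Set a} (P : A → Set ℓ) (f : A → ℕ) B →
                   (∀ c → Dec (∃ λ x → P x × c ≤ f x)) → (∀ {x} → P x → f x ≤ B) →
                   ∃ P → ∃ λ x → P x × (∀ {y} → P y → f y ≤ f x)
maximum-attained P f zero    P? f≤B (x , Px) = x , Px , λ Py → ≤-trans (f≤B Py) z≤n
maximum-attained P f (suc B) P? f≤B ∃P with P? (suc B)
... | yes (x , Px , 1+B≤fx) = x , Px , λ Py → ≤-trans (f≤B Py) 1+B≤fx
... | no ∄x = maximum-attained P f B P? (λ {x} Px → m<1+n⇒m≤n (≰⇒> λ 1+B≤fx → ∄x (x , Px , 1+B≤fx))) ∃P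

heaviest-exists : ∀ (F : Subset n → Set) g → (∀ S → Dec (F S)) → ∃ F →
                  ∃ λ S → F S × (∀ {T} → F T → weight T g ≤ weight S g)
heaviest-exists F g F? =
  maximum-attained F (λ S → weight S g) (weight ⊤ g)
    (λ c → anySubset? (λ S → F? S ×-dec (c ≤? weight S g))) (λ {S} _ → weight-mono-⊆ {p = S} g ⊆⊤)

heaviest-exchange : ∀ {F : Subset n → Set} {S} g → (∀ {T} → F T → weight T g ≤ weight S g) →
                    ∀ {v t} → v ∉ S → t ∈ S → F ((S ∪ ⁅ v ⁆) - t) → g v ≤ g t
heaviest-exchange {S = S} g S-heaviest {v} {t} v∉S t∈S F[S+v-t] =
  +-cancelˡ-≤ (weight S g) (g v) (g t) (begin
    weight S g + g v                        ≡⟨ weight-exchange S g v∉S (p⊆p∪q ⁅ v ⁆ t∈S) ⟨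
    weight ((S ∪ ⁅ v ⁆) - t) g + g t        ≤⟨ +-monoˡ-≤ (g t) (S-heaviest F[S+v-t]) ⟩
    weight S g + g t                        ∎)
  where open ≤-Reasoning

largest-exists : ∀ (p : Subset n) g → Nonempty p → ∃ λ z → z ∈ p × (∀ {y} → y ∈ p → g y ≤ g z)
largest-exists p g =
  maximum-attained (_∈ p) g (weight p g)
    (λ c → any? (λ x → (x ∈? p) ×-dec (c ≤? g x))) g≤weight
  where
  g≤weight : ∀ {x} → x ∈ p → g x ≤ weight p g
  g≤weight {x} x∈p = subst (_≤ weight p g) (weight-⁅⁆ x g) (weight-mono-⊆ g (x∈p⇒⁅x⁆⊆p x∈p))

-- Links and shadows

module _ (H : Subset n → Bool) where

  link : Subset n → Subset n
  link S = tabulate (λ v → not (lookup S v) ∧ H (S ∪ ⁅ v ⁆))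

  degree≡∣link∣ : ∀ S → degree H S ≡ ∣ link S ∣
  degree≡∣link∣ S = count-tabulate (λ v → not (lookup S v) ∧ H (S ∪ ⁅ v ⁆))

  ∈-link⁻ : ∀ {S v} → v ∈ link S → v ∉ S × Edge H (S ∪ ⁅ v ⁆)
  ∈-link⁻ {S} {v} v∈link with lookup S v in Sv≡false | trans (sym (lookup∘tabulate _ v)) ([]=⇒lookup v∈link)
  ... | false | H[S∪v] = (λ v∈S → contradiction (trans (sym ([]=⇒lookup v∈S)) Sv≡false) λ ()) , H[S∪v]

  shadow? : ∀ {r} S → Dec (InShadow r H S)
  shadow? {r} S = (∣ S ∣ ≟ r ∸ 1) ×-dec anySubset? (λ e → (H e Boolₚ.≟ true) ×-dec (S ⊆? e))

  edge-minus-shadow : ∀ {r e x} → IsRGraph r H → Edge H e → x ∈ e → InShadow r H (e - x)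
  edge-minus-shadow {r} {e} {x} r-graph e∈H x∈e = ∣e-x∣≡r∸1 , e , e∈H , p─q⊆p e ⁅ x ⁆
    where
    ∣e-x∣≡r∸1 : ∣ e - x ∣ ≡ r ∸ 1
    ∣e-x∣≡r∸1 = cong (_∸ 1) (trans (1+∣p-x∣≡∣p∣ e x∈e) (r-graph e e∈H))

  module _ {φ : Fin n → Fin k} where

    degree+weight≤n : ∀ {S Z} → Rainbow φ Z → ColourDisjoint φ (link S) Z →
                      degree H S + weight Z (classSize φ) ≤ n
    degree+weight≤n {S} rainbow disjoint =
      subst (λ d → d + _ ≤ n) (sym (degree≡∣link∣ S)) (∣p∣+weight[classSize]≤n φ rainbow disjoint)

    degree≤[k∸∣Z∣]*μ : ∀ {S Z μ} → Rainbow φ Z → ColourDisjoint φ (link S) Z →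
                       (∀ {v} → v ∈ link S → classSize φ v ≤ μ) → degree H S ≤ (k ∸ ∣ Z ∣) * μ
    degree≤[k∸∣Z∣]*μ {S} rainbow disjoint small =
      subst (_≤ _) (sym (degree≡∣link∣ S)) (∣p∣≤[k∸∣Z∣]*μ φ rainbow disjoint small)

    colour-representative : ∀ S i → 0 < preimageSize φ i →
      ∃ λ x → φ x ≡ i × (x ∈ link S ⊎ (∀ {y} → y ∈ link S → φ y ≢ i))
    colour-representative S i 0<ai with any? (λ y → (y ∈? link S) ×-dec (φ y Finₚ.≟ i))
    ... | yes (x , x∈link , φx≡i) = x , φx≡i , inj₁ x∈link
    ... | no ∄x = let x , φx≡i = preimageSize>0⇒∃ φ i 0<ai in
                  x , φx≡i , inj₂ λ y∈link φy≡i → ∄x (_ , y∈link , φy≡i)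

    module _ (hom : IsHom H φ) where

      edge-rainbow : ∀ {e} → Edge H e → Rainbow φ e
      edge-rainbow {e} e∈H = hom e e∈H _ _

      shadow-rainbow : ∀ {r S} → InShadow r H S → Rainbow φ S
      shadow-rainbow (_ , e , e∈H , S⊆e) = Rainbow-⊆ S⊆e (edge-rainbow e∈H)

      link-fresh : ∀ S → ColourDisjoint φ (link S) S
      link-fresh S {v} {y} v∈link y∈S φv≡φy with v∉S , S∪v∈H ← ∈-link⁻ v∈link =
        v∉S (subst (_∈ S) (sym v≡y) y∈S)
        where
        v≡y : v ≡ y
        v≡y = hom (S ∪ ⁅ v ⁆) S∪v∈H v y (q⊆p∪q S ⁅ v ⁆ (x∈⁅x⁆ v)) (p⊆p∪q ⁅ v ⁆ y∈S) φv≡φy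

-- Arithmetic

module _ (p ρ : ℕ) {n d : ℕ} (codegree : (3 * p + 1) * n < d * (3 * p + 3 * ρ + 1)) where

  private
    A D : ℕ
    A = 3 * p + 1
    D = 3 * p + 3 * ρ + 1

  codegree-gapˡ : ∀ {w} → d + w ≤ n → A * w < 3 * ρ * d
  codegree-gapˡ {w} d+w≤n = +-cancelˡ-< (A * d) (A * w) (3 * ρ * d) (begin-strict
    A * d + A * w   ≡⟨ *-distribˡ-+ A d w ⟨
    A * (d + w)     ≤⟨ *-monoʳ-≤ A d+w≤n ⟩
    A * n           <⟨ codegree ⟩
    d * D           ≡⟨ d*D≡A*d+3ρd p ρ d ⟩
    A * d + 3 * ρ * d ∎)
    where
    open ≤-Reasoning
    d*D≡A*d+3ρd : ∀ p ρ d → d * (3 * p + 3 * ρ + 1) ≡ (3 * p + 1) * d + 3 * ρ * d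
    d*D≡A*d+3ρd = solve-∀

  codegree-gapʳ : ∀ {w} → d + w ≤ n → D * w < 3 * ρ * n
  codegree-gapʳ {w} d+w≤n = +-cancelˡ-< (D * d) (D * w) (3 * ρ * n) (begin-strict
    D * d + D * w      ≡⟨ *-distribˡ-+ D d w ⟨
    D * (d + w)        ≤⟨ *-monoʳ-≤ D d+w≤n ⟩
    D * n              ≡⟨ D*n≡A*n+3ρn p ρ n ⟩
    A * n + 3 * ρ * n  <⟨ +-monoˡ-< (3 * ρ * n) codegree ⟩
    d * D + 3 * ρ * n  ≡⟨ cong (_+ 3 * ρ * n) (*-comm d D) ⟩
    D * d + 3 * ρ * n  ∎)
    where
    open ≤-Reasoning
    D*n≡A*n+3ρn : ∀ p ρ n → (3 * p + 3 * ρ + 1) * n ≡ (3 * p + 1) * n + 3 * ρ * n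
    D*n≡A*n+3ρn = solve-∀

  ρc≤w⇒c*D<3n : ∀ {w c} → d + w ≤ n → ρ * c ≤ w → c * D < 3 * n
  ρc≤w⇒c*D<3n {w} {c} d+w≤n ρc≤w = *-cancelˡ-< ρ (c * D) (3 * n) (begin-strict
    ρ * (c * D)  ≡⟨ ρ[cD]≡D[ρc] ρ c D ⟩
    D * (ρ * c)  ≤⟨ *-monoʳ-≤ D ρc≤w ⟩
    D * w        <⟨ codegree-gapʳ d+w≤n ⟩
    3 * ρ * n    ≡⟨ 3ρn≡ρ[3n] ρ n ⟩
    ρ * (3 * n)  ∎)
    where
    open ≤-Reasoning
    ρ[cD]≡D[ρc] : ∀ ρ c D → ρ * (c * D) ≡ D * (ρ * c)
    ρ[cD]≡D[ρc] = solve-∀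
    3ρn≡ρ[3n] : ∀ ρ n → 3 * ρ * n ≡ ρ * (3 * n)
    3ρn≡ρ[3n] = solve-∀

  [1+ρ]μ≤w⇒d≰pμ : ∀ {w μ} → d + w ≤ n → suc ρ * μ ≤ w → d ≰ p * μ
  [1+ρ]μ≤w⇒d≰pμ {w} {μ} d+w≤n [1+ρ]μ≤w d≤pμ = <-irrefl refl (begin-strict
    A * (suc ρ * μ)                           ≤⟨ *-monoʳ-≤ A [1+ρ]μ≤w ⟩
    A * w                                     <⟨ codegree-gapˡ d+w≤n ⟩
    3 * ρ * d                                 ≤⟨ *-monoʳ-≤ (3 * ρ) d≤pμ ⟩
    3 * ρ * (p * μ)                           ≤⟨ m≤m+n (3 * ρ * (p * μ)) _ ⟩
    3 * ρ * (p * μ) + (3 * p * μ + ρ * μ + μ) ≡⟨ expand p ρ μ ⟩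
    A * (suc ρ * μ)                           ∎)
    where
    open ≤-Reasoning
    expand : ∀ p ρ μ → 3 * ρ * (p * μ) + (3 * p * μ + ρ * μ + μ) ≡ (3 * p + 1) * ((1 + ρ) * μ)
    expand = solve-∀

d≤pm⇒d*D≤A*n : ∀ p ρ {n d m} → d ≤ p * m → m * (3 * p + 3 * ρ + 1) < 3 * n →
               d * (3 * p + 3 * ρ + 1) ≤ (3 * p + 1) * n
d≤pm⇒d*D≤A*n p ρ {n} {d} {m} d≤pm mD<3n = begin
  d * D            ≤⟨ *-monoˡ-≤ D d≤pm ⟩
  p * m * D        ≡⟨ *-assoc p m D ⟩
  p * (m * D)      ≤⟨ *-monoʳ-≤ p (<⇒≤ mD<3n) ⟩
  p * (3 * n)      ≤⟨ m≤m+n (p * (3 * n)) n ⟩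
  p * (3 * n) + n  ≡⟨ expand p n ⟩
  (3 * p + 1) * n  ∎
  where
  open ≤-Reasoning
  D = 3 * p + 3 * ρ + 1
  expand : ∀ p n → p * (3 * n) + n ≡ (3 * p + 1) * n
  expand = solve-∀

3[1+ρ+p]∸3[1+ρ]≡3p : ∀ ρ p → 3 * (suc ρ + p) ∸ 3 * suc ρ ≡ 3 * p
3[1+ρ+p]∸3[1+ρ]≡3p ρ p = trans (cong (_∸ 3 * suc ρ) (*-distribˡ-+ 3 (suc ρ) p)) (m+n∸m≡n (3 * suc ρ) (3 * p))

3[1+ρ+p]∸2≡D : ∀ ρ p → 3 * (suc ρ + p) ∸ 2 ≡ 3 * p + 3 * ρ + 1
3[1+ρ+p]∸2≡D ρ p = trans (cong (_∸ 2) (3[1+ρ+p]≡2+D ρ p)) (m+n∸m≡n 2 (3 * p + 3 * ρ + 1))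
  where
  3[1+ρ+p]≡2+D : ∀ ρ p → 3 * (suc ρ + p) ≡ 2 + (3 * p + 3 * ρ + 1)
  3[1+ρ+p]≡2+D = solve-∀

-- The exchange argument

-- Here r = 1 + ρ and k = r + p, so that 3k − 3r + 1 = 3p + 1 and 3k − 2 = D = 3p + 3ρ + 1.
module _ {n ρ p} {H : Subset n → Bool} {φ : Fin n → Fin (suc ρ + p)}
         (r-graph : IsRGraph (suc ρ) H) (hom : IsHom H φ)
         (codegree : ∀ S → InShadow (suc ρ) H S → (3 * p + 1) * n < degree H S * (3 * p + 3 * ρ + 1))
         where

  private
    Shadow : Subset n → Set
    Shadow = InShadow (suc ρ) H

    g : Fin n → ℕ
    g = classSize φ

    D : ℕ
    D = 3 * p + 3 * ρ + 1

  degree≤p*μ : ∀ {S Z μ} → Rainbow φ Z → ∣ Z ∣ ≡ suc ρ → ColourDisjoint φ (link H S) Z →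
               (∀ {v} → v ∈ link H S → g v ≤ μ) → degree H S ≤ p * μ
  degree≤p*μ {S} {Z} {μ} rainbow ∣Z∣≡r disjoint small =
    subst (λ c → degree H S ≤ c * μ) (trans (cong (suc ρ + p ∸_) ∣Z∣≡r) (m+n∸m≡n (suc ρ) p))
      (degree≤[k∸∣Z∣]*μ H rainbow disjoint small)

  heavy-rainbow⇒c*D<3n : ∀ {S Z c} → Shadow S → Rainbow φ Z → ∣ Z ∣ ≡ ρ → ColourDisjoint φ (link H S) Z →
                         (∀ {y} → y ∈ Z → c ≤ g y) → c * D < 3 * n
  heavy-rainbow⇒c*D<3n {S} {Z} {c} S∈∂H rainbow ∣Z∣≡ρ disjoint heavy =
    ρc≤w⇒c*D<3n p ρ (codegree S S∈∂H) (degree+weight≤n H rainbow disjoint)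
      (subst (λ m → m * c ≤ weight Z g) ∣Z∣≡ρ (∣p∣*c≤weight Z heavy))

  shadow-through : 1 ≤ ρ → NoIsolated H → ∀ x → ∃ λ T → Shadow T × ⁅ x ⁆ ⊆ T
  shadow-through 1≤ρ no-isolated x
    with f , f∈H , x∈f ← no-isolated x
    with y , y∈f-x ← ∣p∣>0⇒Nonempty (f - x)
                       (subst (0 <_) (sym (proj₁ (edge-minus-shadow H r-graph f∈H x∈f))) 1≤ρ)
    with y∈f , y≢x ← x∈p-y⁻ y∈f-x =
    f - y , edge-minus-shadow H r-graph f∈H y∈f , x∈p⇒⁅x⁆⊆p (x∈p∧x≢y⇒x∈p-y x∈f (y≢x ∘ sym))

  replace-pair-rainbow : ∀ {e u v x} → Edge H e → u ∈ e → v ∈ e → u ≢ v → (∀ {y} → y ∈ e → φ y ≢ φ x) →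
                         Rainbow φ ((e - u - v) ∪ ⁅ x ⁆) × ∣ (e - u - v) ∪ ⁅ x ⁆ ∣ ≡ ρ
  replace-pair-rainbow {e} {u} {v} {x} e∈H u∈e v∈e u≢v x-fresh =
    Rainbow-∪⁅⁆ (Rainbow-⊆ e-u-v⊆e (edge-rainbow H hom e∈H)) (x-fresh ∘ e-u-v⊆e) ,
    (begin
      ∣ (e - u - v) ∪ ⁅ x ⁆ ∣ ≡⟨ ∣p∪⁅x⁆∣≡1+∣p∣ (e - u - v) (λ x∈e-u-v → x-fresh (e-u-v⊆e x∈e-u-v) refl) ⟩
      suc ∣ e - u - v ∣       ≡⟨ 1+∣p-x∣≡∣p∣ (e - u) v∈e-u ⟩
      ∣ e - u ∣               ≡⟨ proj₁ (edge-minus-shadow H r-graph e∈H u∈e) ⟩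
      ρ                       ∎)
    where
    open ≡-Reasoning
    e-u-v⊆e : e - u - v ⊆ e
    e-u-v⊆e = proj₁ ∘ x∈p-y⁻ ∘ proj₁ ∘ x∈p-y⁻
    v∈e-u : v ∈ e - u
    v∈e-u = x∈p∧x≢y⇒x∈p-y v∈e (u≢v ∘ sym)

  link-nonempty : ∀ {S} → Shadow S → Nonempty (link H S)
  link-nonempty {S} S∈∂H = ∣p∣>0⇒Nonempty (link H S) (subst (0 <_) (degree≡∣link∣ H S) 0<degree)
    where
    0<degree : 0 < degree H S
    0<degree = n≢0⇒n>0 λ d≡0 → <⇒≱ (codegree S S∈∂H) (subst (λ d → d * D ≤ _) (sym d≡0) z≤n)

  fresh-vertex⇒degree≤p*m : ∀ {S x m} → Shadow S → (∀ {v} → v ∈ link H S → g v ≤ m) → m < g x →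
                            (∀ {y} → y ∈ S → φ y ≢ φ x) → degree H S ≤ p * m
  fresh-vertex⇒degree≤p*m {S} {x} S∈∂H small m<gx x-fresh =
    degree≤p*μ (Rainbow-∪⁅⁆ (shadow-rainbow H hom {suc ρ} S∈∂H) x-fresh)
      (trans (∣p∪⁅x⁆∣≡1+∣p∣ S (λ x∈S → x-fresh x∈S refl)) (cong suc (proj₁ S∈∂H)))
      disjoint small
    where
    disjoint : ColourDisjoint φ (link H S) (S ∪ ⁅ x ⁆)
    disjoint {v} {y} v∈link y∈S∪x with x∈p∪q⁻ S ⁅ x ⁆ y∈S∪x
    ... | inj₁ y∈S   = link-fresh H hom S v∈link y∈S
    ... | inj₂ y∈⁅x⁆ = subst (λ y → φ v ≢ φ y) (sym (x∈⁅y⁆⇒x≡y x y∈⁅x⁆))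
                         (classSize<⇒≢ φ (≤-<-trans (small v∈link) m<gx))

  light-vertex⇒no-heavier-rainbow-set :
    ∀ {T t₀ Y} → Shadow T → t₀ ∈ T → (∀ {v} → v ∈ link H T → g v ≤ g t₀) →
    Rainbow φ Y → ∣ Y ∣ ≡ ρ → (∀ {y} → y ∈ Y → g t₀ < g y) → Empty.⊥
  light-vertex⇒no-heavier-rainbow-set {T} {t₀} {Y} T∈∂H t₀∈T small rainbow ∣Y∣≡ρ heavy =
    [1+ρ]μ≤w⇒d≰pμ p ρ (codegree T T∈∂H) (degree+weight≤n H rainbow′ disjoint)
      (subst (λ c → c * g t₀ ≤ weight Z g) ∣Z∣≡r (∣p∣*c≤weight Z heavy′))
      (degree≤p*μ rainbow′ ∣Z∣≡r disjoint small)
    where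
    Z = Y ∪ ⁅ t₀ ⁆
    t₀-fresh : ∀ {y} → y ∈ Y → φ y ≢ φ t₀
    t₀-fresh y∈Y = classSize<⇒≢ φ (heavy y∈Y) ∘ sym
    rainbow′ : Rainbow φ Z
    rainbow′ = Rainbow-∪⁅⁆ rainbow t₀-fresh
    ∣Z∣≡r : ∣ Z ∣ ≡ suc ρ
    ∣Z∣≡r = trans (∣p∪⁅x⁆∣≡1+∣p∣ Y (λ t₀∈Y → t₀-fresh t₀∈Y refl)) (cong suc ∣Y∣≡ρ)
    disjoint : ColourDisjoint φ (link H T) Z
    disjoint {v} {y} v∈link y∈Z with x∈p∪q⁻ Y ⁅ t₀ ⁆ y∈Z
    ... | inj₁ y∈Y    = classSize<⇒≢ φ (≤-<-trans (small v∈link) (heavy y∈Y))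
    ... | inj₂ y∈⁅t₀⁆ = subst (λ y → φ v ≢ φ y) (sym (x∈⁅y⁆⇒x≡y t₀ y∈⁅t₀⁆)) (link-fresh H hom T v∈link t₀∈T)
    heavy′ : ∀ {y} → y ∈ Z → g t₀ ≤ g y
    heavy′ {y} y∈Z with x∈p∪q⁻ Y ⁅ t₀ ⁆ y∈Z
    ... | inj₁ y∈Y    = <⇒≤ (heavy y∈Y)
    ... | inj₂ y∈⁅t₀⁆ = ≤-reflexive (cong g (sym (x∈⁅y⁆⇒x≡y t₀ y∈⁅t₀⁆)))


  heaviest-shadow-containing : ∀ {X} → ∃ (λ T → Shadow T × X ⊆ T) →
    ∃ λ T → Shadow T × X ⊆ T × (∀ {v t} → v ∈ link H T → t ∈ T → t ∉ X → g v ≤ g t)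
  heaviest-shadow-containing {X} ∃T
    with T , (T∈∂H , X⊆T) , T-heaviest ← heaviest-exists (λ T → Shadow T × X ⊆ T) g
                                           (λ T → shadow? H {suc ρ} T ×-dec (X ⊆? T)) ∃T =
    T , T∈∂H , X⊆T , exchange
    where
    exchange : ∀ {v t} → v ∈ link H T → t ∈ T → t ∉ X → g v ≤ g t
    exchange {v} {t} v∈link t∈T t∉X with v∉T , T∪v∈H ← ∈-link⁻ H v∈link =
      heaviest-exchange {F = λ T → Shadow T × X ⊆ T} g T-heaviest v∉T t∈T
        ( edge-minus-shadow H r-graph T∪v∈H (p⊆p∪q ⁅ v ⁆ t∈T)
        , λ y∈X → x∈p∧x≢y⇒x∈p-y (p⊆p∪q ⁅ v ⁆ (X⊆T y∈X)) λ { refl → t∉X y∈X })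

  -- T is a heaviest shadow through x.  If no vertex of T other than x is lighter than z, the
  -- double count on T gives g z · D < 3n, too small for the degree of S, whose link avoids the
  -- colours of S ∪ {x}.  Otherwise some t₀ ∈ T ∖ {x} is lighter than z; it dominates the link
  -- classes of T, while x and the vertices of e ∖ {u, v} are all heavier than t₀.
  no-heavier-missing-colour :
    ∀ {S u v z x T} → u ≢ v → Shadow S → u ∈ S → v ∈ S → z ∈ link H S →
    (∀ {y} → y ∈ link H S → g y ≤ g z) → (∀ {w} → w ∈ S ∪ ⁅ z ⁆ → w ≢ u → w ≢ v → g z ≤ g w) →
    (∀ {y} → y ∈ S ∪ ⁅ z ⁆ → φ y ≢ φ x) → g z < g x →
    Shadow T → (∀ {v t} → v ∈ link H T → t ∈ T → t ∉ ⁅ x ⁆ → g v ≤ g t) → Empty.⊥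
  no-heavier-missing-colour {S} {u} {v} {z} {x} {T}
                            u≢v S∈∂H u∈S v∈S z∈link z-max e-heavy x-fresh gz<gx T∈∂H T-exchange
    with any? (λ t → (t ∈? T) ×-dec (¬? (t Finₚ.≟ x)) ×-dec (g t <? g z))
  ... | yes (t₀ , t₀∈T , t₀≢x , gt₀<gz) =
    light-vertex⇒no-heavier-rainbow-set T∈∂H t₀∈T (λ v∈link → T-exchange v∈link t₀∈T (x≢y⇒x∉⁅y⁆ t₀≢x))
      (proj₁ Y-facts) (proj₂ Y-facts) Y-heavy
    where
    Y-facts : Rainbow φ ((S ∪ ⁅ z ⁆ - u - v) ∪ ⁅ x ⁆) × ∣ (S ∪ ⁅ z ⁆ - u - v) ∪ ⁅ x ⁆ ∣ ≡ ρ
    Y-facts = replace-pair-rainbow (proj₂ (∈-link⁻ H z∈link)) (p⊆p∪q ⁅ z ⁆ u∈S) (p⊆p∪q ⁅ z ⁆ v∈S) u≢v x-fresh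
    Y-heavy : ∀ {y} → y ∈ (S ∪ ⁅ z ⁆ - u - v) ∪ ⁅ x ⁆ → g t₀ < g y
    Y-heavy y∈Y with x∈p∪q⁻ (S ∪ ⁅ z ⁆ - u - v) ⁅ x ⁆ y∈Y
    ... | inj₁ y∈e-u-v with y∈e-u , y≢v ← x∈p-y⁻ y∈e-u-v with y∈e , y≢u ← x∈p-y⁻ y∈e-u =
      <-≤-trans gt₀<gz (e-heavy y∈e y≢u y≢v)
    ... | inj₂ y∈⁅x⁆ = subst (λ y → g t₀ < g y) (sym (x∈⁅y⁆⇒x≡y x y∈⁅x⁆)) (<-trans gt₀<gz gz<gx)
  ... | no ∄t₀ =
    <⇒≱ (codegree S S∈∂H)
      (d≤pm⇒d*D≤A*n p ρ (fresh-vertex⇒degree≤p*m S∈∂H z-max gz<gx (x-fresh ∘ p⊆p∪q ⁅ z ⁆))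
        (heavy-rainbow⇒c*D<3n T∈∂H (shadow-rainbow H hom {suc ρ} T∈∂H) (proj₁ T∈∂H)
          (link-fresh H hom T) T-heavy))
    where
    T-heavy : ∀ {t} → t ∈ T → g z ≤ g t
    T-heavy {t} t∈T with t Finₚ.≟ x
    ... | yes refl = <⇒≤ gz<gx
    ... | no t≢x = ≮⇒≥ λ gt<gz → ∄t₀ (t , t∈T , t≢x , gt<gz)

  MissingColoursBelow : Subset n → Fin n → Fin n → Set
  MissingColoursBelow e u v = ∀ (w : Fin n) → w ∈ e → w ≢ u → w ≢ v →
                              ∀ (i : Fin (suc ρ + p)) → ¬ InImage φ e i → preimageSize φ i ≤ g w

  missing-colours-below-via-shadow :
    1 ≤ ρ → NoIsolated H → ∀ {S₀ u v} → u ≢ v → Shadow S₀ → u ∈ S₀ → v ∈ S₀ →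
    ∃[ e ] (Edge H e × u ∈ e × v ∈ e × MissingColoursBelow e u v)
  missing-colours-below-via-shadow 1≤ρ no-isolated {S₀} {u} {v} u≢v S₀∈∂H u∈S₀ v∈S₀
    with S , S∈∂H , uv⊆S , S-exchange ← heaviest-shadow-containing (S₀ , S₀∈∂H , ⁅x⁆∪⁅y⁆⊆p u∈S₀ v∈S₀)
    with z , z∈link , z-max ← largest-exists (link H S) g (link-nonempty S∈∂H) =
    S ∪ ⁅ z ⁆ , proj₂ (∈-link⁻ H z∈link) , p⊆p∪q ⁅ z ⁆ u∈S , p⊆p∪q ⁅ z ⁆ v∈S , below
    where
    u∈S : u ∈ S
    u∈S = uv⊆S (p⊆p∪q ⁅ v ⁆ (x∈⁅x⁆ u))
    v∈S : v ∈ S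
    v∈S = uv⊆S (q⊆p∪q ⁅ u ⁆ ⁅ v ⁆ (x∈⁅x⁆ v))
    e-heavy : ∀ {w} → w ∈ S ∪ ⁅ z ⁆ → w ≢ u → w ≢ v → g z ≤ g w
    e-heavy w∈e w≢u w≢v with x∈p∪q⁻ S ⁅ z ⁆ w∈e
    ... | inj₁ w∈S   = S-exchange z∈link w∈S (x∉⁅y⁆∪⁅z⁆ w≢u w≢v)
    ... | inj₂ w∈⁅z⁆ = ≤-reflexive (cong g (sym (x∈⁅y⁆⇒x≡y z w∈⁅z⁆)))
    missing≤gz : ∀ i → ¬ InImage φ (S ∪ ⁅ z ⁆) i → preimageSize φ i ≤ g z
    missing≤gz i i∉φe = ≮⇒≥ λ gz<ai →
      let x , φx≡i = preimageSize>0⇒∃ φ i (≤-<-trans z≤n gz<ai)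
          T , T∈∂H , _ , T-exchange = heaviest-shadow-containing (shadow-through 1≤ρ no-isolated x)
      in no-heavier-missing-colour u≢v S∈∂H u∈S v∈S z∈link z-max e-heavy
           (λ y∈e φy≡φx → i∉φe (_ , y∈e , trans φy≡φx φx≡i))
           (subst (λ j → g z < preimageSize φ j) (sym φx≡i) gz<ai) T∈∂H T-exchange
    below : MissingColoursBelow (S ∪ ⁅ z ⁆) u v
    below w w∈e w≢u w≢v i i∉φe = ≤-trans (missing≤gz i i∉φe) (e-heavy w∈e w≢u w≢v)

  -- Trade u, v for a vertex x of colour i.  If x can be taken in the link of e ∖ u, the
  -- resulting set is itself a shadow; otherwise colour i is absent from that link.
  missing-colour*D<3n : ∀ {e u v} → Edge H e → u ∈ e → v ∈ e → u ≢ v → MissingColoursBelow e u v →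
                        ∀ i → ¬ InImage φ e i → preimageSize φ i * D < 3 * n
  missing-colour*D<3n {e} {u} {v} e∈H u∈e v∈e u≢v below i i∉φe with preimageSize φ i ≟ 0
  ... | yes ai≡0 = subst (λ a → a * D < 3 * n) (sym ai≡0) (*-monoʳ-< 3 (>-nonZero⁻¹ n {{nonZeroIndex u}}))
  ... | no ai≢0 with x , φx≡i , x-choice ← colour-representative H (e - u) i (n≢0⇒n>0 ai≢0) =
    let _ , S∈∂H , disjoint = shadow-avoiding-Z x-choice in
    heavy-rainbow⇒c*D<3n S∈∂H (proj₁ Z-facts) (proj₂ Z-facts) disjoint Z-heavy
    where
    Z : Subset n
    Z = (e - u - v) ∪ ⁅ x ⁆
    x-fresh : ∀ {y} → y ∈ e → φ y ≢ φ x
    x-fresh y∈e φy≡φx = i∉φe (_ , y∈e , trans φy≡φx φx≡i)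
    Z-facts : Rainbow φ Z × ∣ Z ∣ ≡ ρ
    Z-facts = replace-pair-rainbow e∈H u∈e v∈e u≢v x-fresh
    Z-heavy : ∀ {y} → y ∈ Z → preimageSize φ i ≤ g y
    Z-heavy {y} y∈Z with x∈p∪q⁻ (e - u - v) ⁅ x ⁆ y∈Z
    ... | inj₁ y∈e-u-v with y∈e-u , y≢v ← x∈p-y⁻ y∈e-u-v with y∈e , y≢u ← x∈p-y⁻ y∈e-u =
      below y y∈e y≢u y≢v i i∉φe
    ... | inj₂ y∈⁅x⁆ = ≤-reflexive (cong (preimageSize φ) (sym (trans (cong φ (x∈⁅y⁆⇒x≡y x y∈⁅x⁆)) φx≡i)))
    shadow-avoiding-Z : x ∈ link H (e - u) ⊎ (∀ {y} → y ∈ link H (e - u) → φ y ≢ i) →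
           ∃ λ S → Shadow S × ColourDisjoint φ (link H S) Z
    shadow-avoiding-Z (inj₁ x∈link) =
      Z , (proj₂ Z-facts , (e - u) ∪ ⁅ x ⁆ , proj₂ (∈-link⁻ H x∈link) , Z⊆) , link-fresh H hom Z
      where
      Z⊆ : Z ⊆ (e - u) ∪ ⁅ x ⁆
      Z⊆ y∈Z with x∈p∪q⁻ (e - u - v) ⁅ x ⁆ y∈Z
      ... | inj₁ y∈e-u-v = p⊆p∪q ⁅ x ⁆ (proj₁ (x∈p-y⁻ y∈e-u-v))
      ... | inj₂ y∈⁅x⁆   = q⊆p∪q (e - u) ⁅ x ⁆ y∈⁅x⁆
    shadow-avoiding-Z (inj₂ ∄i-in-link) = e - u , edge-minus-shadow H r-graph e∈H u∈e , disjoint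
      where
      disjoint : ColourDisjoint φ (link H (e - u)) Z
      disjoint {v′} v′∈link y∈Z with x∈p∪q⁻ (e - u - v) ⁅ x ⁆ y∈Z
      ... | inj₁ y∈e-u-v = link-fresh H hom (e - u) v′∈link (proj₁ (x∈p-y⁻ y∈e-u-v))
      ... | inj₂ y∈⁅x⁆   = λ φv′≡φy →
        ∄i-in-link v′∈link (trans φv′≡φy (trans (cong φ (x∈⁅y⁆⇒x≡y x y∈⁅x⁆)) φx≡i))

  missing-colours-below-exists :
    1 ≤ ρ → NoIsolated H → ∀ {e₀ u v} → u ≢ v → Edge H e₀ → u ∈ e₀ → v ∈ e₀ →
    ∃[ e ] (Edge H e × u ∈ e × v ∈ e × MissingColoursBelow e u v)
  missing-colours-below-exists 1≤ρ no-isolated {e₀} {u} {v} u≢v e₀∈H u∈e₀ v∈e₀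
    with any? (λ w → (w ∈? e₀) ×-dec ¬? (w Finₚ.≟ u) ×-dec ¬? (w Finₚ.≟ v))
  ... | yes (w , w∈e₀ , w≢u , w≢v) =
    missing-colours-below-via-shadow 1≤ρ no-isolated u≢v (edge-minus-shadow H r-graph e₀∈H w∈e₀)
      (x∈p∧x≢y⇒x∈p-y u∈e₀ (w≢u ∘ sym)) (x∈p∧x≢y⇒x∈p-y v∈e₀ (w≢v ∘ sym))
  ... | no ∄w = e₀ , e₀∈H , u∈e₀ , v∈e₀ , λ w w∈e₀ w≢u w≢v → contradiction (w , w∈e₀ , w≢u , w≢v) ∄w

codegree-reindexed : ∀ {n ρ p} {H : Subset n → Bool} →
  MinPosCodegreeAbove (suc ρ) H (3 * (suc ρ + p) ∸ 3 * suc ρ + 1) (3 * (suc ρ + p) ∸ 2) →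
  ∀ S → InShadow (suc ρ) H S → (3 * p + 1) * n < degree H S * (3 * p + 3 * ρ + 1)
codegree-reindexed {n} {ρ} {p} {H} codegree S S∈∂H =
  subst₂ (λ a b → a * n < degree H S * b) (cong (_+ 1) (3[1+ρ+p]∸3[1+ρ]≡3p ρ p)) (3[1+ρ+p]∸2≡D ρ p)
    (codegree S S∈∂H)

proposition2p18 : (n k r : ℕ) → 2 ≤ r → r ≤ k → k ≤ n →
    (H : Subset n → Bool) → IsRGraph r H → Colorable k H → NoIsolated H →
    MinPosCodegreeAbove r H (3 * k ∸ 3 * r + 1) (3 * k ∸ 2) →
    MinPosCodegreeAbove r H (k ∸ r + 1) (k + 2) →
    (φ : Fin n → Fin k) → IsHom H φ →
    (u v : Fin n) → u ≢ v → ∃[ e₀ ] (Edge H e₀ × u ∈ e₀ × v ∈ e₀) →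
    ∃[ e ] (Edge H e × u ∈ e × v ∈ e ×
      (∀ (w : Fin n) → w ∈ e → w ≢ u → w ≢ v →
        ∀ (i : Fin k) → ¬ InImage φ e i → preimageSize φ i ≤ classSize φ w) ×
      (∀ (i : Fin k) → ¬ InImage φ e i → preimageSize φ i * (3 * k ∸ 2) < 3 * n))
proposition2p18 n k (suc ρ) (s≤s 1≤ρ) r≤k _ H r-graph _ no-isolated codegree _ φ hom u v u≢v
                (e₀ , e₀∈H , u∈e₀ , v∈e₀)
  with p , refl ← m≤n⇒∃[o]m+o≡n r≤k
  with e , e∈H , u∈e , v∈e , below ←
         missing-colours-below-exists r-graph hom (codegree-reindexed codegree) 1≤ρ no-isolated
           u≢v e₀∈H u∈e₀ v∈e₀ =
  e , e∈H , u∈e , v∈e , below , λ i i∉φe →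
    subst (λ D → preimageSize φ i * D < 3 * n) (sym (3[1+ρ+p]∸2≡D ρ p))
      (missing-colour*D<3n r-graph hom (codegree-reindexed codegree) e∈H u∈e v∈e u≢v below i i∉φe)
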